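{- Let $Y\Rightarrow^\ast Y^\prime$ in a normalized grammar $\langle N, \Sigma, P, S^\bullet\rangle$ by means of nonterminal rules, where $Y,Y^\prime$ are hypergraphs. If $\mathrm{HL} \vdash Y \to A$ for any type $A$, then $\mathrm{HL} \vdash Y^\prime+\sum\limits_{r \in P_N} k_{r}\cdot \mathrm{DPO}(r)^\bullet \to A$ for some $k_r \in \mathbb{N}$ (namely $k_r$ is the number of applications of $r$ in the derivation $Y\Rightarrow^\ast Y'$).
   Context: Hypergraphs are $\langle V,E,att,lab,ext\rangle$ up to isomorphism; $G[e/H]$ is hyperedge replacement; $a^\bullet$ is the handle; $+$ is disjoint union (one summand zero rank) and $k\cdot H$ is $k$-fold disjoint union. Let $\mathrm{Dis}_k=\langle[k],\emptyset,\emptyset,\emptyset,\Lambda\rangle$ be the discrete hypergraph with $k$ nodes. A DPO rule is $r=(L\overset{\varphi_L}{\leftarrow}\mathrm{Dis}_k\overset{\varphi_R}{\rightarrow}R)$ with $L,R$ zero rank; $\widehat{L}$ (resp. $\widehat R$) is $L$ (resp. $R$) with external nodes $\varphi_L(1)\dots\varphi_L(k)$ (resp. $\varphi_R(1)\dots\varphi_R(k)$). $G\underset{r}{\Rightarrow}H$ iff there is $C'$ with a hyperedge $e_0$ such that $C'[e_0/\widehat L]\cong G$, $C'[e_0/\widehat R]\cong H$. A normalized DPO grammar has, for each terminal $a$, a nonterminal $T_a$; its nonterminal rules $P_N$ use only nonterminal labels, and its remaining (terminal) rules are $T_a^\circ\leftarrow\mathrm{Dis}_{rk(a)}\rightarrow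 a^\circ$. Nonterminals are primitive types of the hypergraph Lambek calculus $\mathrm{HL}$ (constructors $\div$, $\times$; axiom $A^\bullet\to A$; rules $(\div\to)$, $(\to\div)$, $(\times\to)$, $(\to\times)$). For $r\in P_N$, $\mathrm{DPO}(r)\eqdef\times(\widehat L)\div(\widehat R+\$_0^\bullet)$, a type of rank $0$. -}

module Defs where

open import Data.Nat using (ℕ; zero; suc; pred; _+_)
open import Data.Fin using (Fin; zero; suc; toℕ; punchIn; _↑ˡ_; _↑ʳ_; splitAt)
open import Data.Fin.Properties using (_≟_)
open import Data.List using (List; tabulate; map)
open import Data.Product using (Σ; ∃; _,_; _×_; uncurry)
open import Data.Sum using (_⊎_; inj₁; inj₂; [_,_])
open import Data.Empty using (⊥)
open import Relation.Nullary using (yes; no)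
open import Relation.Binary.PropositionalEquality using (_≡_; refl)
open import Relation.Binary.Construct.Closure.Equivalence using (EqClosure)
open import Function.Bundles using (_↔_; _⇔_; Inverse)

-- Hypergraphs are only ever compared up to isomorphism (see _≅_ below).

record Hyp (L : Set) (rk : L → ℕ) : Set where
  field
    nV   : ℕ
    nE   : ℕ
    lab  : Fin nE → L
    att  : (e : Fin nE) → Fin (rk (lab e)) → Fin nV
    nExt : ℕ
    ext  : Fin nExt → Fin nV
open Hyp public

attList : {L : Set} {rk : L → ℕ} (H : Hyp L rk) → Fin (nE H) → List (Fin (nV H))
attList H e = tabulate (att H e)

extList : {L : Set} {rk : L → ℕ} (H : Hyp L rk) → List (Fin (nV H))
extList H = tabulate (ext H)

-- Contexts: a hypergraph (the kept edges) together with nH "holes",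
-- i.e. additional hyperedges that are going to be replaced.
-- Hole j has rank hrk j and attachment hatt j.

record Ctx (L : Set) (rk : L → ℕ) : Set where
  field
    base : Hyp L rk
    nH   : ℕ
    hrk  : Fin nH → ℕ
    hatt : (j : Fin nH) → Fin (hrk j) → Fin (nV base)
open Ctx public

NodeSum : {L : Set} {rk : L → ℕ} (C : Ctx L rk) (Hs : Fin (nH C) → Hyp L rk) → Set
NodeSum C Hs = Fin (nV (base C)) ⊎ Σ (Fin (nH C)) (λ j → Fin (nV (Hs j)))

data Glue {L : Set} {rk : L → ℕ} (C : Ctx L rk) (Hs : Fin (nH C) → Hyp L rk)
          : NodeSum C Hs → NodeSum C Hs → Set where
  glue : (j : Fin (nH C)) (i : Fin (hrk C j)) (i' : Fin (nExt (Hs j))) →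
         toℕ i ≡ toℕ i' →
         Glue C Hs (inj₁ (hatt C j i)) (inj₂ (j , ext (Hs j) i'))

-- Fill C Hs K : K is (isomorphic to) the result of simultaneously
-- replacing every hole j of C by Hs j (hyperedge replacement).
-- This is the usual pushout description of C[e_j / Hs j]:
-- nodes are the disjoint union of all nodes modulo the equivalence
-- generated by the gluing, edges are the disjoint union of all edges.
record Fill {L : Set} {rk : L → ℕ} (C : Ctx L rk) (Hs : Fin (nH C) → Hyp L rk)
            (K : Hyp L rk) : Set where
  field
    rkOk  : ∀ j → hrk C j ≡ nExt (Hs j)
    f     : Fin (nV (base C)) → Fin (nV K)
    g     : (j : Fin (nH C)) → Fin (nV (Hs j)) → Fin (nV K)
  F : NodeSum C Hs → Fin (nV K)
  F = [ f , uncurry g ]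
  field
    onto  : ∀ v → ∃ λ x → F x ≡ v
    ker   : ∀ x y → (F x ≡ F y) ⇔ EqClosure (Glue C Hs) x y
    edges : (Fin (nE (base C)) ⊎ Σ (Fin (nH C)) (λ j → Fin (nE (Hs j)))) ↔ Fin (nE K)
  φ : (Fin (nE (base C)) ⊎ Σ (Fin (nH C)) (λ j → Fin (nE (Hs j)))) → Fin (nE K)
  φ = Inverse.to edges
  field
    labˡ  : ∀ e → lab K (φ (inj₁ e)) ≡ lab (base C) e
    labʳ  : ∀ j h → lab K (φ (inj₂ (j , h))) ≡ lab (Hs j) h
    attˡ  : ∀ e → attList K (φ (inj₁ e)) ≡ map f (attList (base C) e)
    attʳ  : ∀ j h → attList K (φ (inj₂ (j , h))) ≡ map (g j) (attList (Hs j) h)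
    extOk : extList K ≡ map f (extList (base C))

asCtx : {L : Set} {rk : L → ℕ} → Hyp L rk → Ctx L rk
asCtx G = record { base = G ; nH = 0 ; hrk = λ () ; hatt = λ () }

_≅_ : {L : Set} {rk : L → ℕ} → Hyp L rk → Hyp L rk → Set
G ≅ K = Fill (asCtx G) (λ ()) K

holeCtx : {L : Set} {rk : L → ℕ} (B : Hyp L rk) (d : ℕ) → (Fin d → Fin (nV B)) → Ctx L rk
holeCtx B d a = record { base = B ; nH = 1 ; hrk = λ _ → d ; hatt = λ _ → a }

-- the context G with hyperedge e turned into a hole, so that
-- Fill (removeEdge G e) (λ _ → H) K  means  K ≅ G[e/H]
dropLab : {L : Set} {n : ℕ} → (Fin n → L) → Fin n → Fin (pred n) → L
dropLab {n = suc n} lab e e' = lab (punchIn e e')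

dropAtt : {L : Set} {rk : L → ℕ} {n : ℕ} {X : Set} (lab : Fin n → L)
          (att : (e : Fin n) → Fin (rk (lab e)) → X) (e : Fin n)
          (e' : Fin (pred n)) → Fin (rk (dropLab lab e e')) → X
dropAtt {n = suc n} lab att e e' = att (punchIn e e')

removeEdge : {L : Set} {rk : L → ℕ} (G : Hyp L rk) → Fin (nE G) → Ctx L rk
removeEdge {rk = rk} G e = record
  { base = record
      { nV = nV G ; nE = pred (nE G)
      ; lab = dropLab (lab G) e
      ; att = dropAtt {rk = rk} (lab G) (att G) e
      ; nExt = nExt G ; ext = ext G }
  ; nH = 1 ; hrk = λ _ → rk (lab G e) ; hatt = λ _ → att G e }

allHoles : {L : Set} {rk : L → ℕ} (M : Hyp L rk) → Ctx L rk
allHoles {rk = rk} M = record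
  { base = record { nV = nV M ; nE = 0 ; lab = λ () ; att = λ () ; nExt = nExt M ; ext = ext M }
  ; nH = nE M ; hrk = λ i → rk (lab M i) ; hatt = att M }

handle : {L : Set} {rk : L → ℕ} → L → Hyp L rk
handle {rk = rk} a = record
  { nV = rk a ; nE = 1 ; lab = λ _ → a ; att = λ _ v → v ; nExt = rk a ; ext = λ v → v }

emptyH : {L : Set} {rk : L → ℕ} → Hyp L rk
emptyH = record { nV = 0 ; nE = 0 ; lab = λ () ; att = λ () ; nExt = 0 ; ext = λ () }

-- disjoint union G + H (external nodes: those of G followed by those of H;
-- in all uses below at least one summand has rank zero)
module _ {L : Set} {rk : L → ℕ} (G H : Hyp L rk) where
  private
    labS : Fin (nE G) ⊎ Fin (nE H) → L
    labS = [ lab G , lab H ]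
    attS : (x : Fin (nE G) ⊎ Fin (nE H)) → Fin (rk (labS x)) → Fin (nV G + nV H)
    attS (inj₁ e) v = att G e v ↑ˡ nV H
    attS (inj₂ e) v = nV G ↑ʳ att H e v
    extS : Fin (nExt G) ⊎ Fin (nExt H) → Fin (nV G + nV H)
    extS (inj₁ i) = ext G i ↑ˡ nV H
    extS (inj₂ i) = nV G ↑ʳ ext H i

  _⊕_ : Hyp L rk
  _⊕_ = record
    { nV = nV G + nV H ; nE = nE G + nE H
    ; lab = λ e → labS (splitAt (nE G) e)
    ; att = λ e → attS (splitAt (nE G) e)
    ; nExt = nExt G + nExt H
    ; ext = λ i → extS (splitAt (nExt G) i) }

_·_ : {L : Set} {rk : L → ℕ} → ℕ → Hyp L rk → Hyp L rk
zero  · H = emptyH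
suc k · H = H ⊕ (k · H)

bigSum : {L : Set} {rk : L → ℕ} (m : ℕ) → (Fin m → Hyp L rk) → Hyp L rk
bigSum zero    F = emptyH
bigSum (suc m) F = F zero ⊕ bigSum m (λ i → F (suc i))

module _ {Nt : Set} (rkN : Nt → ℕ) where

  mutual
    data Tp : Set where
      prim : Nt → Tp
      -- N ÷ D : D is a hypergraph over types plus exactly one $-edge of
      -- rank d attached at dAtt; |ext_D| = rk N; rk (N ÷ D) = d
      div  : (N : Tp) (D : Hyp Tp rk) (d : ℕ) (dAtt : Fin d → Fin (nV D)) →
             rk N ≡ nExt D → Tp
      times : Hyp Tp rk → Tp

    rk : Tp → ℕ
    rk (prim n)           = rkN n
    rk (div N D d dAtt p) = d
    rk (times M)          = nExt M

  -- D with the $-edge relabelled by N ÷ D, and all other edges of D holes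
  divCtx : (N : Tp) (D : Hyp Tp rk) (d : ℕ) (dAtt : Fin d → Fin (nV D)) →
           rk N ≡ nExt D → Ctx Tp rk
  divCtx N D d dAtt p = record
    { base = record { nV = nV D ; nE = 1 ; lab = λ _ → div N D d dAtt p
                    ; att = λ _ → dAtt ; nExt = nExt D ; ext = ext D }
    ; nH = nE D ; hrk = λ i → rk (lab D i) ; hatt = att D }

  data ⊢_⇒_ : Hyp Tp rk → Tp → Set where
    ax    : ∀ {A K} → K ≅ handle A → ⊢ K ⇒ A
    divL  : ∀ {N D d dAtt p A K D₁} (H : Hyp Tp rk) (e : Fin (nE H)) →
            lab H e ≡ N → ⊢ H ⇒ A →
            (Hs : Fin (nE D) → Hyp Tp rk) → (∀ i → ⊢ Hs i ⇒ lab D i) →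
            Fill (divCtx N D d dAtt p) Hs D₁ →
            Fill (removeEdge H e) (λ _ → D₁) K →
            ⊢ K ⇒ A
    divR  : ∀ {N D d dAtt p F K} → Fill (holeCtx D d dAtt) (λ _ → F) K →
            ⊢ K ⇒ N → ⊢ F ⇒ div N D d dAtt p
    timesL : ∀ {A M K} (H : Hyp Tp rk) (e : Fin (nE H)) → lab H e ≡ times M →
             Fill (removeEdge H e) (λ _ → M) K → ⊢ K ⇒ A → ⊢ H ⇒ A
    timesR : ∀ {M K} (Hs : Fin (nE M) → Hyp Tp rk) → (∀ i → ⊢ Hs i ⇒ lab M i) →
             Fill (allHoles M) Hs K → ⊢ K ⇒ times M

module _ {Nt : Set} (rkN : Nt → ℕ) where

  -- r = (L ←φL– Dis_k –φR→ R), with L, R of rank zero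
  record Rule : Set where
    field
      k     : ℕ
      L     : Hyp Nt rkN
      R     : Hyp Nt rkN
      Lzero : nExt L ≡ 0
      Rzero : nExt R ≡ 0
      φL    : Fin k → Fin (nV L)
      φR    : Fin k → Fin (nV R)

    hatL : Hyp Nt rkN
    hatL = record L { nExt = k ; ext = φL }
    hatR : Hyp Nt rkN
    hatR = record R { nExt = k ; ext = φR }
  open Rule public

  -- G ⇒_r H : there is C' with a hyperedge e0 (here: a hole of rank k)
  -- with C'[e0/\hat L] ≅ G and C'[e0/\hat R] ≅ H
  record Step (r : Rule) (G H : Hyp Nt rkN) : Set where
    field
      C'   : Hyp Nt rkN
      e0   : Fin (k r) → Fin (nV C')
      repL : Fill (holeCtx C' (k r) e0) (λ _ → hatL r) G
      repR : Fill (holeCtx C' (k r) e0) (λ _ → hatR r) H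

  data Derivs {m : ℕ} (PN : Fin m → Rule) : Hyp Nt rkN → Hyp Nt rkN → Set where
    done : ∀ {G H} → G ≅ H → Derivs PN G H
    step : ∀ {G G₁ H} (i : Fin m) → Step (PN i) G G₁ → Derivs PN G₁ H → Derivs PN G H

  count : ∀ {m} {PN : Fin m → Rule} {G H} → Derivs PN G H → Fin m → ℕ
  count (done _) i = 0
  count (step j _ δ) i with j ≟ i
  ... | yes _ = suc (count δ i)
  ... | no  _ = count δ i

  prims : Hyp Nt rkN → Hyp (Tp rkN) (rk rkN)
  prims G = record
    { nV = nV G ; nE = nE G ; lab = λ e → prim (lab G e) ; att = att G
    ; nExt = nExt G ; ext = ext G }

  -- DPO(r) = ×(\hat L) ÷ (\hat R + $_0^•), a type of rank 0
  DPO : Rule → Tp rkN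
  DPO r = div (times (prims (hatL r))) (prims (hatR r)) 0 (λ ()) refl

-- A derivation step G = C'[L̂] ⇒ C'[R̂] = G₁ is simulated by two HL rules.
-- From ⊢ G + W → A, rule (×→) folds the copy of L̂ into a single ×(L̂)-edge of C'; rule (÷→)
-- then replaces that edge by the denominator R̂ + $⁰ of DPO(r) = ×(L̂) ÷ (R̂ + $⁰), whose edges are
-- discharged by axioms and whose $-edge becomes a DPO(r)•-summand: ⊢ G₁ + DPO(r)• + W → A.
-- Derivability is invariant under isomorphism, and disjoint union of rank-zero hypergraphs is
-- associative and commutative, so the handles collected along the derivation can be sorted by
-- rule, giving exactly k_r copies of DPO(r)•.

module Submission where

open import Defs
open import Level using (0ℓ)
open import Data.Nat using (ℕ; zero; suc; _+_; pred)
open import Data.Nat.Properties using (+-suc; +-identityʳ)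
open import Data.Fin using (Fin; zero; suc; toℕ; _↑ˡ_; _↑ʳ_; splitAt; punchIn)
open import Data.Fin.Properties
  using (+↔⊎; splitAt-↑ˡ; splitAt-↑ʳ; splitAt⁻¹-↑ˡ; splitAt⁻¹-↑ʳ; toℕ-↑ˡ; toℕ-injective; _≟_)
open import Data.Fin.Permutation using (remove; punchIn-permute)
open import Data.Vec.Functional using (updateAt)
open import Data.Vec.Functional.Properties using (updateAt-updates; updateAt-minimal)
open import Data.List using ([]; _∷_; tabulate; map; _++_; length)
open import Data.List.Properties
  using (map-tabulate; tabulate-cong; map-++; map-∘; map-cong; map-id; ++-assoc; ++-identityʳ;
         length-tabulate; ∷-injectiveˡ; ∷-injectiveʳ)
open import Data.Product using (Σ; ∃; _,_; _×_; proj₁; proj₂; uncurry)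
open import Data.Sum using (_⊎_; inj₁; inj₂; [_,_])
open import Data.Sum.Function.Propositional using (_⊎-↔_)
open import Data.Empty using (⊥; ⊥-elim)
open import Relation.Nullary using (yes; no)
open import Relation.Binary.Structures using (IsEquivalence)
open import Relation.Binary.PropositionalEquality
  using (_≡_; refl; sym; trans; cong; cong₂; subst; isEquivalence; module ≡-Reasoning)
open import Relation.Binary.Construct.Closure.Equivalence using (EqClosure)
import Relation.Binary.Construct.Closure.Equivalence as EC
open import Relation.Binary.Construct.Closure.ReflexiveTransitive using (ε; _◅_; _◅◅_)
open import Relation.Binary.Construct.Closure.Symmetric using (fwd; bwd)
open import Function using (_∘_)
open import Function.Bundles using (_↔_; Inverse; mk↔ₛ′; mk⇔; Equivalence)
open import Function.Properties.Inverse using (↔-refl; ↔-sym; ↔-trans)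
open import Function.Related.TypeIsomorphisms using (⊎-assoc; ⊎-comm)

open Inverse using (to; from; strictlyInverseˡ; strictlyInverseʳ)

data SplitView (m n : ℕ) : Fin (m + n) → Set where
  inl : (i : Fin m) → SplitView m n (i ↑ˡ n)
  inr : (j : Fin n) → SplitView m n (m ↑ʳ j)

splitView : ∀ m n (x : Fin (m + n)) → SplitView m n x
splitView m n x with splitAt m x in eq
... | inj₁ i = subst (SplitView m n) (splitAt⁻¹-↑ˡ eq) (inl i)
... | inj₂ j = subst (SplitView m n) (splitAt⁻¹-↑ʳ eq) (inr j)

+-↔ : ∀ {a a' b b'} → Fin a ↔ Fin a' → Fin b ↔ Fin b' → Fin (a + b) ↔ Fin (a' + b')
+-↔ σ τ = ↔-trans +↔⊎ (↔-trans (σ ⊎-↔ τ) (↔-sym +↔⊎))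

module _ {a a' b b'} (σ : Fin a ↔ Fin a') (τ : Fin b ↔ Fin b') where
  +-↔-↑ˡ : ∀ i → to (+-↔ σ τ) (i ↑ˡ b) ≡ to σ i ↑ˡ b'
  +-↔-↑ˡ i rewrite splitAt-↑ˡ a i b = refl

  +-↔-↑ʳ : ∀ j → to (+-↔ σ τ) (a ↑ʳ j) ≡ a' ↑ʳ to τ j
  +-↔-↑ʳ j rewrite splitAt-↑ʳ a b j = refl

+-identityʳ-↔ : ∀ n → Fin n ↔ Fin (n + 0)
+-identityʳ-↔ n = ↔-sym (↔-trans +↔⊎ Fin0-absorbs)
  where
  Fin0-absorbs : (Fin n ⊎ Fin 0) ↔ Fin n
  Fin0-absorbs = mk↔ₛ′ [ (λ i → i) , (λ ()) ] inj₁ (λ _ → refl) λ { (inj₁ _) → refl ; (inj₂ ()) }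

module _ (a b c : ℕ) where
  +-assoc-↔ : Fin ((a + b) + c) ↔ Fin (a + (b + c))
  +-assoc-↔ = ↔-trans +↔⊎ (↔-trans (+↔⊎ ⊎-↔ ↔-refl)
                (↔-trans (⊎-assoc 0ℓ (Fin a) (Fin b) (Fin c))
                (↔-trans (↔-refl ⊎-↔ ↔-sym +↔⊎) (↔-sym +↔⊎))))

  +-assoc-↔-↑ˡ↑ˡ : ∀ i → to +-assoc-↔ ((i ↑ˡ b) ↑ˡ c) ≡ i ↑ˡ (b + c)
  +-assoc-↔-↑ˡ↑ˡ i rewrite splitAt-↑ˡ (a + b) (i ↑ˡ b) c | splitAt-↑ˡ a i b = refl

  +-assoc-↔-↑ʳ↑ˡ : ∀ j → to +-assoc-↔ ((a ↑ʳ j) ↑ˡ c) ≡ a ↑ʳ (j ↑ˡ c)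
  +-assoc-↔-↑ʳ↑ˡ j rewrite splitAt-↑ˡ (a + b) (a ↑ʳ j) c | splitAt-↑ʳ a b j = refl

  +-assoc-↔-↑ʳ : ∀ k → to +-assoc-↔ ((a + b) ↑ʳ k) ≡ a ↑ʳ (b ↑ʳ k)
  +-assoc-↔-↑ʳ k rewrite splitAt-↑ʳ (a + b) c k = refl

module _ (a b : ℕ) where
  +-comm-↔ : Fin (a + b) ↔ Fin (b + a)
  +-comm-↔ = ↔-trans +↔⊎ (↔-trans (⊎-comm (Fin a) (Fin b)) (↔-sym +↔⊎))

  +-comm-↔-↑ˡ : ∀ i → to +-comm-↔ (i ↑ˡ b) ≡ b ↑ʳ i
  +-comm-↔-↑ˡ i rewrite splitAt-↑ˡ a i b = refl

  +-comm-↔-↑ʳ : ∀ j → to +-comm-↔ (a ↑ʳ j) ≡ j ↑ˡ a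
  +-comm-↔-↑ʳ j rewrite splitAt-↑ʳ a b j = refl

Fin0-elim : ∀ {m} → m ≡ 0 → Fin m → ⊥
Fin0-elim refl ()

map-map-≗ : ∀ {A B C : Set} {g : B → C} {f : A → B} {h : A → C} →
            (∀ x → g (f x) ≡ h x) → ∀ xs → map g (map f xs) ≡ map h xs
map-map-≗ p xs = trans (sym (map-∘ xs)) (map-cong p xs)

map-square : ∀ {A B B' C : Set} {f : A → B} {g : B → C} {f' : A → B'} {g' : B' → C} →
             (∀ x → g (f x) ≡ g' (f' x)) → ∀ xs → map g (map f xs) ≡ map g' (map f' xs)
map-square p xs = trans (map-map-≗ p xs) (sym (map-map-≗ (λ _ → refl) xs))

map-from-to : ∀ {A B : Set} (σ : A ↔ B) xs → map (from σ) (map (to σ) xs) ≡ xs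
map-from-to σ xs = trans (map-map-≗ (strictlyInverseʳ σ) xs) (map-id xs)

tabulate-++ : ∀ {A : Set} m n (h : Fin (m + n) → A) →
              tabulate h ≡ tabulate (λ i → h (i ↑ˡ n)) ++ tabulate (λ j → h (m ↑ʳ j))
tabulate-++ zero    n h = refl
tabulate-++ (suc m) n h = cong (h zero ∷_) (tabulate-++ m n (λ x → h (suc x)))

tabulate-0 : ∀ {A : Set} {n} (f : Fin n → A) → n ≡ 0 → tabulate f ≡ []
tabulate-0 {n = zero} f _ = refl

tabulate-≡⇒length : ∀ {A : Set} {n m} {f : Fin n → A} {g : Fin m → A} →
                    tabulate f ≡ tabulate g → n ≡ m
tabulate-≡⇒length {f = f} {g} eq =
  trans (sym (length-tabulate f)) (trans (cong length eq) (length-tabulate g))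

tabulate-≡⇒pointwise : ∀ {A : Set} {n m} {f : Fin n → A} {g : Fin m → A} →
                       tabulate f ≡ tabulate g → ∀ i → ∃ λ j → toℕ j ≡ toℕ i × f i ≡ g j
tabulate-≡⇒pointwise {n = suc n} {suc m} eq zero = zero , refl , ∷-injectiveˡ eq
tabulate-≡⇒pointwise {n = suc n} {suc m} eq (suc i)
  with tabulate-≡⇒pointwise (∷-injectiveʳ eq) i
... | j , j≡i , fi≡gj = suc j , cong suc j≡i , fi≡gj

module _ {A B : Set} {n m : ℕ} {f : Fin n → B} {g : Fin m → A} {h : A → B}
         (eq : tabulate f ≡ map h (tabulate g)) where
  tabulate-≡-map⇒pointwise : ∀ i → ∃ λ j → toℕ j ≡ toℕ i × f i ≡ h (g j)
  tabulate-≡-map⇒pointwise = tabulate-≡⇒pointwise (trans eq (map-tabulate g h))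

  tabulate-≡-map⇒pointwise⁻ : ∀ j → ∃ λ i → toℕ i ≡ toℕ j × f i ≡ h (g j)
  tabulate-≡-map⇒pointwise⁻ j with tabulate-≡⇒pointwise (sym (trans eq (map-tabulate g h))) j
  ... | i , i≡j , hgj≡fi = i , i≡j , sym hgj≡fi

module _ {A : Set} {R : A → A → Set} where
  single : ∀ {x y} → R x y → EqClosure R x y
  single r = fwd r ◅ ε

  ≡⇒EqClosure : ∀ {x y} → x ≡ y → EqClosure R x y
  ≡⇒EqClosure = IsEquivalence.reflexive (EC.isEquivalence R)

-- removeEdge numbers the remaining hyperedges by Fin (pred n), hence the variants over pred.
punchIn′ : ∀ {n} → Fin n → Fin (pred n) → Fin n
punchIn′ {suc n} = punchIn

remove-↔ : ∀ {n n'} (π : Fin n ↔ Fin n') (e : Fin n) →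
           Σ (Fin (pred n) ↔ Fin (pred n')) λ ρ → ∀ x → to π (punchIn′ e x) ≡ punchIn′ (to π e) (to ρ x)
remove-↔ {suc n} {suc n'} π e = remove e π , punchIn-permute π e
remove-↔ {suc n} {zero}   π e with to π e
... | ()

-- Isomorphisms and fills

module _ {L : Set} {rk : L → ℕ} where

  record Iso (G K : Hyp L rk) : Set where
    field
      nodeIso  : Fin (nV G) ↔ Fin (nV K)
      edgeIso  : Fin (nE G) ↔ Fin (nE K)
      lab≡     : ∀ e → lab K (to edgeIso e) ≡ lab G e
      attList≡ : ∀ e → attList K (to edgeIso e) ≡ map (to nodeIso) (attList G e)
      extList≡ : extList K ≡ map (to nodeIso) (extList G)
  open Iso public

  Iso-refl : (G : Hyp L rk) → Iso G G
  Iso-refl G = record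
    { nodeIso = ↔-refl ; edgeIso = ↔-refl ; lab≡ = λ _ → refl
    ; attList≡ = λ e → sym (map-id _) ; extList≡ = sym (map-id _) }

  Iso-sym : {G K : Hyp L rk} → Iso G K → Iso K G
  Iso-sym {G} {K} φ = record
    { nodeIso = ↔-sym ν ; edgeIso = ↔-sym η
    ; lab≡ = λ e → trans (sym (lab≡ φ (from η e))) (cong (lab K) (strictlyInverseˡ η e))
    ; attList≡ = λ e → sym (begin
        map (from ν) (attList K e)
          ≡⟨ cong (map (from ν) ∘ attList K) (sym (strictlyInverseˡ η e)) ⟩
        map (from ν) (attList K (to η (from η e)))
          ≡⟨ cong (map (from ν)) (attList≡ φ (from η e)) ⟩
        map (from ν) (map (to ν) (attList G (from η e)))
          ≡⟨ map-from-to ν _ ⟩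
        attList G (from η e) ∎)
    ; extList≡ = sym (trans (cong (map (from ν)) (extList≡ φ)) (map-from-to ν _)) }
    where
    open ≡-Reasoning
    ν = nodeIso φ
    η = edgeIso φ

  Iso-trans : {G H K : Hyp L rk} → Iso G H → Iso H K → Iso G K
  Iso-trans φ ψ = record
    { nodeIso = ↔-trans (nodeIso φ) (nodeIso ψ) ; edgeIso = ↔-trans (edgeIso φ) (edgeIso ψ)
    ; lab≡ = λ e → trans (lab≡ ψ _) (lab≡ φ e)
    ; attList≡ = λ e → trans (attList≡ ψ _)
                         (trans (cong (map (to (nodeIso ψ))) (attList≡ φ e)) (map-map-≗ (λ _ → refl) _))
    ; extList≡ = trans (extList≡ ψ) (trans (cong (map (to (nodeIso ψ))) (extList≡ φ)) (map-map-≗ (λ _ → refl) _))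
    }

  EdgeSum : (C : Ctx L rk) (Hs : Fin (nH C) → Hyp L rk) → Set
  EdgeSum C Hs = Fin (nE (base C)) ⊎ Σ (Fin (nH C)) (λ j → Fin (nE (Hs j)))

  -- The kernel condition follows from representatives: rep is a section of F = [ f , uncurry g ]
  -- and every x is glued to rep (F x).
  mkFill : (C : Ctx L rk) (Hs : Fin (nH C) → Hyp L rk) (K : Hyp L rk)
    (rkOk : ∀ j → hrk C j ≡ nExt (Hs j))
    (f : Fin (nV (base C)) → Fin (nV K)) (g : (j : Fin (nH C)) → Fin (nV (Hs j)) → Fin (nV K))
    (rep : Fin (nV K) → NodeSum C Hs)
    (F-rep : ∀ v → [ f , uncurry g ] (rep v) ≡ v)
    (glue-rep : ∀ x → EqClosure (Glue C Hs) x (rep ([ f , uncurry g ] x)))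
    (F-resp : ∀ {x y} → Glue C Hs x y → [ f , uncurry g ] x ≡ [ f , uncurry g ] y)
    (edges : EdgeSum C Hs ↔ Fin (nE K))
    (labˡ : ∀ e → lab K (to edges (inj₁ e)) ≡ lab (base C) e)
    (labʳ : ∀ j h → lab K (to edges (inj₂ (j , h))) ≡ lab (Hs j) h)
    (attˡ : ∀ e → attList K (to edges (inj₁ e)) ≡ map f (attList (base C) e))
    (attʳ : ∀ j h → attList K (to edges (inj₂ (j , h))) ≡ map (g j) (attList (Hs j) h))
    (extOk : extList K ≡ map f (extList (base C)))
    → Fill C Hs K
  mkFill C Hs K rkOk f g rep F-rep glue-rep F-resp edges labˡ labʳ attˡ attʳ extOk = record
    { rkOk = rkOk ; f = f ; g = g
    ; onto = λ v → rep v , F-rep v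
    ; ker = λ x y → mk⇔
        (λ Fx≡Fy → glue-rep x ◅◅ subst (λ z → EqClosure (Glue C Hs) (rep z) y) (sym Fx≡Fy)
                                         (EC.symmetric _ (glue-rep y)))
        (EC.gfold isEquivalence [ f , uncurry g ] F-resp)
    ; edges = edges
    ; labˡ = labˡ ; labʳ = labʳ ; attˡ = attˡ ; attʳ = attʳ ; extOk = extOk }

  module FillProps {C : Ctx L rk} {Hs : Fin (nH C) → Hyp L rk} {K : Hyp L rk} (fl : Fill C Hs K) where
    open Fill fl public hiding (φ)

    rep : Fin (nV K) → NodeSum C Hs
    rep v = proj₁ (onto v)

    F-rep : ∀ v → F (rep v) ≡ v
    F-rep v = proj₂ (onto v)

    glue-rep : ∀ x → EqClosure (Glue C Hs) x (rep (F x))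
    glue-rep x = Equivalence.to (ker x (rep (F x))) (sym (F-rep (F x)))

    F-resp : ∀ {x y} → Glue C Hs x y → F x ≡ F y
    F-resp {x} {y} gl = Equivalence.from (ker x y) (single gl)

  private
    glueHole : {C : Ctx L rk} {Hs : Fin (nH C) → Hyp L rk} {x y : NodeSum C Hs} → Glue C Hs x y → Fin (nH C)
    glueHole (glue j _ _ _) = j

    noGlue : {G : Hyp L rk} {x y : NodeSum (asCtx G) (λ ())} → Glue (asCtx G) (λ ()) x y → ⊥
    noGlue gl with glueHole gl
    ... | ()

    node : {G : Hyp L rk} → NodeSum (asCtx G) (λ ()) → Fin (nV G)
    node (inj₁ v) = v
    node (inj₂ (() , _))

    edge : {G : Hyp L rk} → EdgeSum (asCtx G) (λ ()) → Fin (nE G)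
    edge (inj₁ e) = e
    edge (inj₂ (() , _))

  Iso⇒≅ : {G K : Hyp L rk} → Iso G K → G ≅ K
  Iso⇒≅ {G} {K} φ = mkFill (asCtx G) (λ ()) K (λ ()) (to ν) (λ ())
    (λ v → inj₁ (from ν v)) (strictlyInverseˡ ν)
    (λ { (inj₁ v) → ≡⇒EqClosure (cong inj₁ (sym (strictlyInverseʳ ν v))) ; (inj₂ (() , _)) })
    (λ gl → ⊥-elim (noGlue gl))
    (mk↔ₛ′ (λ { (inj₁ e) → to η e ; (inj₂ (() , _)) }) (λ e → inj₁ (from η e))
           (strictlyInverseˡ η) (λ { (inj₁ e) → cong inj₁ (strictlyInverseʳ η e) ; (inj₂ (() , _)) }))
    (lab≡ φ) (λ ()) (attList≡ φ) (λ ()) (extList≡ φ)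
    where
    ν = nodeIso φ
    η = edgeIso φ

  ≅⇒Iso : {G K : Hyp L rk} → G ≅ K → Iso G K
  ≅⇒Iso {G} {K} fl = record
    { nodeIso = mk↔ₛ′ f (node ∘ rep) f-node-rep node-rep-f
    ; edgeIso = mk↔ₛ′ (to edges ∘ inj₁) (edge ∘ from edges) edge-to-from edge-from-to
    ; lab≡ = labˡ ; attList≡ = attˡ ; extList≡ = extOk }
    where
    open FillProps fl
    F-node : ∀ x → F x ≡ f (node {G} x)
    F-node (inj₁ v) = refl
    F-node (inj₂ (() , _))
    f-node-rep : ∀ v → f (node (rep v)) ≡ v
    f-node-rep v = trans (sym (F-node (rep v))) (F-rep v)
    node-rep-f : ∀ v → node (rep (f v)) ≡ v
    node-rep-f v = sym (cong node (EC.gfold isEquivalence (λ z → z) (λ gl → ⊥-elim (noGlue gl)) (glue-rep (inj₁ v))))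
    to-edge : ∀ x → to edges x ≡ to edges (inj₁ (edge {G} x))
    to-edge (inj₁ e) = refl
    to-edge (inj₂ (() , _))
    edge-to-from : ∀ e → to edges (inj₁ (edge (from edges e))) ≡ e
    edge-to-from e = trans (sym (to-edge (from edges e))) (strictlyInverseˡ edges e)
    edge-from-to : ∀ e → edge (from edges (to edges (inj₁ e))) ≡ e
    edge-from-to e = cong edge (strictlyInverseʳ edges (inj₁ e))

  nExt-Iso : {G K : Hyp L rk} → Iso G K → nExt G ≡ nExt K
  nExt-Iso φ = sym (tabulate-≡⇒length (trans (extList≡ φ) (map-tabulate _ _)))

  Fill-resp-result : {C : Ctx L rk} {Hs : Fin (nH C) → Hyp L rk} {K K' : Hyp L rk} →
                     Fill C Hs K → Iso K K' → Fill C Hs K'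
  Fill-resp-result {C} {Hs} {K} {K'} fl φ =
    mkFill C Hs K' rkOk (σ ∘ f) (λ j → σ ∘ g j) (rep ∘ from ν) F'-rep glue-rep' F'-resp
      (↔-trans edges (edgeIso φ))
      (λ e → trans (lab≡ φ _) (labˡ e)) (λ j h → trans (lab≡ φ _) (labʳ j h))
      (λ e → trans (attList≡ φ _) (trans (cong (map σ) (attˡ e)) (map-map-≗ (λ _ → refl) _)))
      (λ j h → trans (attList≡ φ _) (trans (cong (map σ) (attʳ j h)) (map-map-≗ (λ _ → refl) _)))
      (trans (extList≡ φ) (trans (cong (map σ) extOk) (map-map-≗ (λ _ → refl) _)))
    where
    open FillProps fl
    ν = nodeIso φ
    σ = to ν
    F' = [ σ ∘ f , uncurry (λ j → σ ∘ g j) ]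
    F'≡σF : ∀ x → F' x ≡ σ (F x)
    F'≡σF (inj₁ _) = refl
    F'≡σF (inj₂ _) = refl
    F'-rep : ∀ v → F' (rep (from ν v)) ≡ v
    F'-rep v = trans (F'≡σF (rep (from ν v))) (trans (cong σ (F-rep (from ν v))) (strictlyInverseˡ ν v))
    glue-rep' : ∀ x → EqClosure (Glue C Hs) x (rep (from ν (F' x)))
    glue-rep' x rewrite F'≡σF x | strictlyInverseʳ ν (F x) = glue-rep x
    F'-resp : ∀ {x y} → Glue C Hs x y → F' x ≡ F' y
    F'-resp {x} {y} gl = trans (F'≡σF x) (trans (cong σ (F-resp gl)) (sym (F'≡σF y)))

  Fill-resp-fillers : {C : Ctx L rk} {Hs Hs' : Fin (nH C) → Hyp L rk} {K : Hyp L rk} →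
                      Fill C Hs K → (∀ j → Iso (Hs j) (Hs' j)) → Fill C Hs' K
  Fill-resp-fillers {C} {Hs} {Hs'} {K} fl φ =
    mkFill C Hs' K (λ j → trans (rkOk j) (nExt-Iso (φ j))) f g' (β ∘ rep) F'-rep glue-rep' F'-resp
      (↔-trans edgeSum-↔ edges)
      labˡ
      (λ j h → trans (labʳ j _) (trans (sym (lab≡ (φ j) _)) (cong (lab (Hs' j)) (strictlyInverseˡ (η j) h))))
      attˡ attʳ' extOk
    where
    open FillProps fl
    open ≡-Reasoning
    ν : ∀ j → Fin (nV (Hs j)) ↔ Fin (nV (Hs' j))
    ν j = nodeIso (φ j)
    η : ∀ j → Fin (nE (Hs j)) ↔ Fin (nE (Hs' j))
    η j = edgeIso (φ j)
    g' : (j : Fin (nH C)) → Fin (nV (Hs' j)) → Fin (nV K)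
    g' j x = g j (from (ν j) x)
    F' = [ f , uncurry g' ]
    α : NodeSum C Hs' → NodeSum C Hs
    α (inj₁ b) = inj₁ b
    α (inj₂ (j , w)) = inj₂ (j , from (ν j) w)
    β : NodeSum C Hs → NodeSum C Hs'
    β (inj₁ b) = inj₁ b
    β (inj₂ (j , w)) = inj₂ (j , to (ν j) w)
    αβ : ∀ x → α (β x) ≡ x
    αβ (inj₁ b) = refl
    αβ (inj₂ (j , w)) = cong (λ z → inj₂ (j , z)) (strictlyInverseʳ (ν j) w)
    βα : ∀ x → β (α x) ≡ x
    βα (inj₁ b) = refl
    βα (inj₂ (j , w)) = cong (λ z → inj₂ (j , z)) (strictlyInverseˡ (ν j) w)
    F'≡Fα : ∀ x → F' x ≡ F (α x)
    F'≡Fα (inj₁ b) = refl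
    F'≡Fα (inj₂ (j , w)) = refl
    F'-rep : ∀ v → F' (β (rep v)) ≡ v
    F'-rep v = trans (F'≡Fα (β (rep v))) (trans (cong F (αβ (rep v))) (F-rep v))
    glue-β : ∀ {x y} → Glue C Hs x y → EqClosure (Glue C Hs') (β x) (β y)
    glue-β (glue j i i' i≡i') with tabulate-≡-map⇒pointwise⁻ (extList≡ (φ j)) i'
    ... | i₂ , i₂≡i' , ext≡ = subst (λ z → EqClosure (Glue C Hs') (inj₁ (hatt C j i)) (inj₂ (j , z))) ext≡
                                (single (glue j i i₂ (trans i≡i' (sym i₂≡i'))))
    glue-rep' : ∀ x → EqClosure (Glue C Hs') x (β (rep (F' x)))
    glue-rep' x rewrite F'≡Fα x = subst (λ z → EqClosure (Glue C Hs') z (β (rep (F (α x))))) (βα x)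
                                    (EC.gfold (EC.isEquivalence _) β glue-β (glue-rep (α x)))
    F'-resp : ∀ {x y} → Glue C Hs' x y → F' x ≡ F' y
    F'-resp (glue j i i₂ i≡i₂) with tabulate-≡-map⇒pointwise (extList≡ (φ j)) i₂
    ... | i' , i'≡i₂ , ext≡ = trans (F-resp (glue j i i' (trans i≡i₂ (sym i'≡i₂))))
                                (cong (g j) (sym (trans (cong (from (ν j)) ext≡) (strictlyInverseʳ (ν j) _))))
    edgeSum-↔ : EdgeSum C Hs' ↔ EdgeSum C Hs
    edgeSum-↔ = mk↔ₛ′
      (λ { (inj₁ e) → inj₁ e ; (inj₂ (j , h)) → inj₂ (j , from (η j) h) })
      (λ { (inj₁ e) → inj₁ e ; (inj₂ (j , h)) → inj₂ (j , to (η j) h) })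
      (λ { (inj₁ e) → refl ; (inj₂ (j , h)) → cong (λ z → inj₂ (j , z)) (strictlyInverseʳ (η j) h) })
      (λ { (inj₁ e) → refl ; (inj₂ (j , h)) → cong (λ z → inj₂ (j , z)) (strictlyInverseˡ (η j) h) })
    attʳ' : ∀ j h → attList K (to edges (to edgeSum-↔ (inj₂ (j , h)))) ≡ map (g' j) (attList (Hs' j) h)
    attʳ' j h = begin
      attList K (to edges (inj₂ (j , from (η j) h)))
        ≡⟨ attʳ j _ ⟩
      map (g j) (attList (Hs j) (from (η j) h))
        ≡⟨ map-map-≗ (λ x → cong (g j) (strictlyInverseʳ (ν j) x)) _ ⟨
      map (g' j) (map (to (ν j)) (attList (Hs j) (from (η j) h)))
        ≡⟨ cong (map (g' j)) (attList≡ (φ j) _) ⟨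
      map (g' j) (attList (Hs' j) (to (η j) (from (η j) h)))
        ≡⟨ cong (map (g' j) ∘ attList (Hs' j)) (strictlyInverseˡ (η j) h) ⟩
      map (g' j) (attList (Hs' j) h) ∎

  dropLab-punchIn : ∀ {n} (lb : Fin n → L) e x → dropLab lb e x ≡ lb (punchIn′ e x)
  dropLab-punchIn {suc n} lb e x = refl

  dropAtt-punchIn : ∀ {n X} (lb : Fin n → L) (at : (e : Fin n) → Fin (rk (lb e)) → X) e x →
                    tabulate (dropAtt {rk = rk} lb at e x) ≡ tabulate (at (punchIn′ e x))
  dropAtt-punchIn {suc n} lb at e x = refl

  Fill-resp-removeEdge : {M K : Hyp L rk} (H H' : Hyp L rk) (φ : Iso H H') (e : Fin (nE H)) →
                         Fill (removeEdge H e) (λ _ → M) K → Fill (removeEdge H' (to (edgeIso φ) e)) (λ _ → M) K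
  Fill-resp-removeEdge {M} {K} H H' φ e fl =
    mkFill C' (λ _ → M) K (λ j → trans (cong rk (lab≡ φ e)) (rkOk j)) f' g (β ∘ rep) F'-rep glue-rep' F'-resp
      (↔-trans edgeSum-↔ edges) labˡ' labʳ attˡ' attʳ extOk'
    where
    open FillProps fl
    open ≡-Reasoning
    C = removeEdge H e
    ν = nodeIso φ
    η = edgeIso φ
    e' = to η e
    C' = removeEdge H' e'
    ρ = proj₁ (remove-↔ η e)
    f' = f ∘ from ν
    F' = [ f' , uncurry g ]
    α : NodeSum C' (λ _ → M) → NodeSum C (λ _ → M)
    α (inj₁ b) = inj₁ (from ν b)
    α (inj₂ p) = inj₂ p
    β : NodeSum C (λ _ → M) → NodeSum C' (λ _ → M)
    β (inj₁ b) = inj₁ (to ν b)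
    β (inj₂ p) = inj₂ p
    αβ : ∀ x → α (β x) ≡ x
    αβ (inj₁ b) = cong inj₁ (strictlyInverseʳ ν b)
    αβ (inj₂ p) = refl
    βα : ∀ x → β (α x) ≡ x
    βα (inj₁ b) = cong inj₁ (strictlyInverseˡ ν b)
    βα (inj₂ p) = refl
    F'≡Fα : ∀ x → F' x ≡ F (α x)
    F'≡Fα (inj₁ b) = refl
    F'≡Fα (inj₂ p) = refl
    F'-rep : ∀ v → F' (β (rep v)) ≡ v
    F'-rep v = trans (F'≡Fα (β (rep v))) (trans (cong F (αβ (rep v))) (F-rep v))
    glue-β : ∀ {x y} → Glue C (λ _ → M) x y → EqClosure (Glue C' (λ _ → M)) (β x) (β y)
    glue-β (glue j i i' i≡i') with tabulate-≡-map⇒pointwise⁻ (attList≡ φ e) i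
    ... | i₂ , i₂≡i , att≡ = subst (λ z → EqClosure (Glue C' (λ _ → M)) (inj₁ z) (inj₂ (j , ext M i'))) att≡
                               (single (glue j i₂ i' (trans i₂≡i i≡i')))
    glue-rep' : ∀ x → EqClosure (Glue C' (λ _ → M)) x (β (rep (F' x)))
    glue-rep' x rewrite F'≡Fα x = subst (λ z → EqClosure (Glue C' (λ _ → M)) z (β (rep (F (α x))))) (βα x)
                                    (EC.gfold (EC.isEquivalence _) β glue-β (glue-rep (α x)))
    F'-resp : ∀ {x y} → Glue C' (λ _ → M) x y → F' x ≡ F' y
    F'-resp (glue j i₂ i' i₂≡i') with tabulate-≡-map⇒pointwise (attList≡ φ e) i₂
    ... | i , i≡i₂ , att≡ = trans (cong f (trans (cong (from ν) att≡) (strictlyInverseʳ ν _)))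
                              (F-resp (glue j i i' (trans i≡i₂ i₂≡i')))
    edgeSum-↔ : EdgeSum C' (λ _ → M) ↔ EdgeSum C (λ _ → M)
    edgeSum-↔ = mk↔ₛ′
      (λ { (inj₁ x) → inj₁ (from ρ x) ; (inj₂ p) → inj₂ p })
      (λ { (inj₁ x) → inj₁ (to ρ x) ; (inj₂ p) → inj₂ p })
      (λ { (inj₁ x) → cong inj₁ (strictlyInverseʳ ρ x) ; (inj₂ p) → refl })
      (λ { (inj₁ x) → cong inj₁ (strictlyInverseˡ ρ x) ; (inj₂ p) → refl })
    punchIn-ρ : ∀ x → punchIn′ e' x ≡ to η (punchIn′ e (from ρ x))
    punchIn-ρ x = trans (cong (punchIn′ e') (sym (strictlyInverseˡ ρ x))) (sym (proj₂ (remove-↔ η e) (from ρ x)))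
    labˡ' : ∀ x → lab K (to edges (inj₁ (from ρ x))) ≡ lab (base C') x
    labˡ' x = begin
      lab K (to edges (inj₁ (from ρ x)))    ≡⟨ labˡ (from ρ x) ⟩
      dropLab (lab H) e (from ρ x)          ≡⟨ dropLab-punchIn (lab H) e (from ρ x) ⟩
      lab H (punchIn′ e (from ρ x))         ≡⟨ lab≡ φ _ ⟨
      lab H' (to η (punchIn′ e (from ρ x))) ≡⟨ cong (lab H') (punchIn-ρ x) ⟨
      lab H' (punchIn′ e' x)                ≡⟨ dropLab-punchIn (lab H') e' x ⟨
      dropLab (lab H') e' x                 ∎
    f'∘to≡f : ∀ xs → map f' (map (to ν) xs) ≡ map f xs
    f'∘to≡f = map-map-≗ (λ z → cong f (strictlyInverseʳ ν z))
    attˡ' : ∀ x → attList K (to edges (inj₁ (from ρ x))) ≡ map f' (attList (base C') x)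
    attˡ' x = begin
      attList K (to edges (inj₁ (from ρ x)))
        ≡⟨ attˡ (from ρ x) ⟩
      map f (tabulate (dropAtt {rk = rk} (lab H) (att H) e (from ρ x)))
        ≡⟨ cong (map f) (dropAtt-punchIn (lab H) (att H) e (from ρ x)) ⟩
      map f (attList H (punchIn′ e (from ρ x)))
        ≡⟨ f'∘to≡f _ ⟨
      map f' (map (to ν) (attList H (punchIn′ e (from ρ x))))
        ≡⟨ cong (map f') (attList≡ φ _) ⟨
      map f' (attList H' (to η (punchIn′ e (from ρ x))))
        ≡⟨ cong (map f' ∘ attList H') (punchIn-ρ x) ⟨
      map f' (attList H' (punchIn′ e' x))
        ≡⟨ cong (map f') (dropAtt-punchIn (lab H') (att H') e' x) ⟨
      map f' (tabulate (dropAtt {rk = rk} (lab H') (att H') e' x)) ∎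
    extOk' : extList K ≡ map f' (extList H')
    extOk' = begin
      extList K                      ≡⟨ extOk ⟩
      map f (extList H)              ≡⟨ f'∘to≡f _ ⟨
      map f' (map (to ν) (extList H)) ≡⟨ cong (map f') (extList≡ φ) ⟨
      map f' (extList H')            ∎

module _ {Nt : Set} (rkN : Nt → ℕ) where
  ⊢-resp-Iso : ∀ {K K' A} → ⊢_⇒_ rkN K A → Iso K K' → ⊢_⇒_ rkN K' A
  ⊢-resp-Iso (ax K≅A) φ = ax (Iso⇒≅ (Iso-trans (Iso-sym φ) (≅⇒Iso K≅A)))
  ⊢-resp-Iso (divL H e eq d Hs ds F₁ F₂) φ = divL H e eq d Hs ds F₁ (Fill-resp-result F₂ φ)
  ⊢-resp-Iso (divR F d) φ = divR (Fill-resp-fillers F (λ _ → φ)) d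
  ⊢-resp-Iso {K' = H'} (timesL H e eq F d) φ =
    timesL H' (to (edgeIso φ) e) (trans (lab≡ φ e) eq) (Fill-resp-removeEdge H H' φ e F) d
  ⊢-resp-Iso (timesR Hs ds F) φ = timesR Hs ds (Fill-resp-result F φ)

-- Disjoint union

module _ {L : Set} {rk : L → ℕ} where
  module _ (G H : Hyp L rk) where
    lab-⊕-↑ˡ : ∀ e → lab (G ⊕ H) (e ↑ˡ nE H) ≡ lab G e
    lab-⊕-↑ˡ e rewrite splitAt-↑ˡ (nE G) e (nE H) = refl

    lab-⊕-↑ʳ : ∀ e → lab (G ⊕ H) (nE G ↑ʳ e) ≡ lab H e
    lab-⊕-↑ʳ e rewrite splitAt-↑ʳ (nE G) (nE H) e = refl

    attList-⊕-↑ˡ : ∀ e → attList (G ⊕ H) (e ↑ˡ nE H) ≡ map (_↑ˡ nV H) (attList G e)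
    attList-⊕-↑ˡ e rewrite splitAt-↑ˡ (nE G) e (nE H) = sym (map-tabulate _ _)

    attList-⊕-↑ʳ : ∀ e → attList (G ⊕ H) (nE G ↑ʳ e) ≡ map (nV G ↑ʳ_) (attList H e)
    attList-⊕-↑ʳ e rewrite splitAt-↑ʳ (nE G) (nE H) e = sym (map-tabulate _ _)

    ext-⊕-↑ˡ : ∀ i → ext (G ⊕ H) (i ↑ˡ nExt H) ≡ ext G i ↑ˡ nV H
    ext-⊕-↑ˡ i rewrite splitAt-↑ˡ (nExt G) i (nExt H) = refl

    ext-⊕-↑ʳ : ∀ i → ext (G ⊕ H) (nExt G ↑ʳ i) ≡ nV G ↑ʳ ext H i
    ext-⊕-↑ʳ i rewrite splitAt-↑ʳ (nExt G) (nExt H) i = refl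

    extList-⊕ : extList (G ⊕ H) ≡ map (_↑ˡ nV H) (extList G) ++ map (nV G ↑ʳ_) (extList H)
    extList-⊕ = trans (tabulate-++ (nExt G) (nExt H) _)
                  (cong₂ _++_ (trans (tabulate-cong ext-⊕-↑ˡ) (sym (map-tabulate _ _)))
                              (trans (tabulate-cong ext-⊕-↑ʳ) (sym (map-tabulate _ _))))

  ⊕-cong : {G G' H H' : Hyp L rk} → Iso G G' → Iso H H' → Iso (G ⊕ H) (G' ⊕ H')
  ⊕-cong {G} {G'} {H} {H'} φ ψ = record
    { nodeIso = +-↔ (nodeIso φ) (nodeIso ψ) ; edgeIso = +-↔ (edgeIso φ) (edgeIso ψ)
    ; lab≡ = lab≡' ; attList≡ = attList≡' ; extList≡ = extList≡' }
    where
    open ≡-Reasoning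
    σ = nodeIso φ
    τ = nodeIso ψ
    στ = to (+-↔ σ τ)
    lab≡' : ∀ x → lab (G' ⊕ H') (to (+-↔ (edgeIso φ) (edgeIso ψ)) x) ≡ lab (G ⊕ H) x
    lab≡' x with splitView (nE G) (nE H) x
    ... | inl e rewrite +-↔-↑ˡ (edgeIso φ) (edgeIso ψ) e =
      trans (lab-⊕-↑ˡ G' H' _) (trans (lab≡ φ e) (sym (lab-⊕-↑ˡ G H e)))
    ... | inr e rewrite +-↔-↑ʳ (edgeIso φ) (edgeIso ψ) e =
      trans (lab-⊕-↑ʳ G' H' _) (trans (lab≡ ψ e) (sym (lab-⊕-↑ʳ G H e)))
    attList≡' : ∀ x → attList (G' ⊕ H') (to (+-↔ (edgeIso φ) (edgeIso ψ)) x) ≡ map στ (attList (G ⊕ H) x)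
    attList≡' x with splitView (nE G) (nE H) x
    ... | inl e rewrite +-↔-↑ˡ (edgeIso φ) (edgeIso ψ) e | attList-⊕-↑ˡ G H e = begin
      attList (G' ⊕ H') (to (edgeIso φ) e ↑ˡ nE H')      ≡⟨ attList-⊕-↑ˡ G' H' _ ⟩
      map (_↑ˡ nV H') (attList G' (to (edgeIso φ) e))   ≡⟨ cong (map (_↑ˡ nV H')) (attList≡ φ e) ⟩
      map (_↑ˡ nV H') (map (to σ) (attList G e))         ≡⟨ map-map-≗ (λ _ → refl) _ ⟩
      map (λ v → to σ v ↑ˡ nV H') (attList G e)          ≡⟨ map-map-≗ (+-↔-↑ˡ σ τ) _ ⟨
      map στ (map (_↑ˡ nV H) (attList G e))              ∎
    ... | inr e rewrite +-↔-↑ʳ (edgeIso φ) (edgeIso ψ) e | attList-⊕-↑ʳ G H e = begin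
      attList (G' ⊕ H') (nE G' ↑ʳ to (edgeIso ψ) e)      ≡⟨ attList-⊕-↑ʳ G' H' _ ⟩
      map (nV G' ↑ʳ_) (attList H' (to (edgeIso ψ) e))   ≡⟨ cong (map (nV G' ↑ʳ_)) (attList≡ ψ e) ⟩
      map (nV G' ↑ʳ_) (map (to τ) (attList H e))         ≡⟨ map-map-≗ (λ _ → refl) _ ⟩
      map (λ v → nV G' ↑ʳ to τ v) (attList H e)          ≡⟨ map-map-≗ (+-↔-↑ʳ σ τ) _ ⟨
      map στ (map (nV G ↑ʳ_) (attList H e))              ∎
    extList≡' : extList (G' ⊕ H') ≡ map στ (extList (G ⊕ H))
    extList≡' = begin
      extList (G' ⊕ H')
        ≡⟨ extList-⊕ G' H' ⟩
      map (_↑ˡ nV H') (extList G') ++ map (nV G' ↑ʳ_) (extList H')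
        ≡⟨ cong₂ _++_ (trans (cong (map (_↑ˡ nV H')) (extList≡ φ)) (map-map-≗ (λ _ → refl) (extList G)))
                      (trans (cong (map (nV G' ↑ʳ_)) (extList≡ ψ)) (map-map-≗ (λ _ → refl) (extList H))) ⟩
      map (λ v → to σ v ↑ˡ nV H') (extList G) ++ map (λ v → nV G' ↑ʳ to τ v) (extList H)
        ≡⟨ cong₂ _++_ (map-map-≗ (+-↔-↑ˡ σ τ) (extList G)) (map-map-≗ (+-↔-↑ʳ σ τ) (extList H)) ⟨
      map στ (map (_↑ˡ nV H) (extList G)) ++ map στ (map (nV G ↑ʳ_) (extList H))
        ≡⟨ map-++ στ (map (_↑ˡ nV H) (extList G)) (map (nV G ↑ʳ_) (extList H)) ⟨
      map στ (map (_↑ˡ nV H) (extList G) ++ map (nV G ↑ʳ_) (extList H))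
        ≡⟨ cong (map στ) (extList-⊕ G H) ⟨
      map στ (extList (G ⊕ H)) ∎

  ⊕-identityʳ : (X : Hyp L rk) → Iso X (X ⊕ emptyH)
  ⊕-identityʳ X = record
    { nodeIso = +-identityʳ-↔ (nV X) ; edgeIso = +-identityʳ-↔ (nE X)
    ; lab≡ = lab-⊕-↑ˡ X emptyH ; attList≡ = attList-⊕-↑ˡ X emptyH
    ; extList≡ = trans (extList-⊕ X emptyH) (++-identityʳ _) }

  ⊕-comm : (G H : Hyp L rk) → nExt G ≡ 0 → nExt H ≡ 0 → Iso (G ⊕ H) (H ⊕ G)
  ⊕-comm G H G-rank0 H-rank0 = record
    { nodeIso = +-comm-↔ (nV G) (nV H) ; edgeIso = +-comm-↔ (nE G) (nE H)
    ; lab≡ = lab≡' ; attList≡ = attList≡'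
    ; extList≡ = trans (tabulate-0 _ (cong₂ _+_ H-rank0 G-rank0))
                       (sym (cong (map _) (tabulate-0 _ (cong₂ _+_ G-rank0 H-rank0)))) }
    where
    lab≡' : ∀ x → lab (H ⊕ G) (to (+-comm-↔ (nE G) (nE H)) x) ≡ lab (G ⊕ H) x
    lab≡' x with splitView (nE G) (nE H) x
    ... | inl i rewrite +-comm-↔-↑ˡ (nE G) (nE H) i = trans (lab-⊕-↑ʳ H G i) (sym (lab-⊕-↑ˡ G H i))
    ... | inr j rewrite +-comm-↔-↑ʳ (nE G) (nE H) j = trans (lab-⊕-↑ˡ H G j) (sym (lab-⊕-↑ʳ G H j))
    attList≡' : ∀ x → attList (H ⊕ G) (to (+-comm-↔ (nE G) (nE H)) x)
                      ≡ map (to (+-comm-↔ (nV G) (nV H))) (attList (G ⊕ H) x)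
    attList≡' x with splitView (nE G) (nE H) x
    ... | inl i rewrite +-comm-↔-↑ˡ (nE G) (nE H) i | attList-⊕-↑ˡ G H i =
      trans (attList-⊕-↑ʳ H G i) (sym (map-map-≗ (+-comm-↔-↑ˡ (nV G) (nV H)) _))
    ... | inr j rewrite +-comm-↔-↑ʳ (nE G) (nE H) j | attList-⊕-↑ʳ G H j =
      trans (attList-⊕-↑ˡ H G j) (sym (map-map-≗ (+-comm-↔-↑ʳ (nV G) (nV H)) _))

  ⊕-assoc : (G H J : Hyp L rk) → Iso ((G ⊕ H) ⊕ J) (G ⊕ (H ⊕ J))
  ⊕-assoc G H J = record
    { nodeIso = +-assoc-↔ (nV G) (nV H) (nV J) ; edgeIso = +-assoc-↔ (nE G) (nE H) (nE J)
    ; lab≡ = lab≡' ; attList≡ = attList≡' ; extList≡ = extList≡' }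
    where
    open ≡-Reasoning
    A = to (+-assoc-↔ (nV G) (nV H) (nV J))
    Aᴱ = to (+-assoc-↔ (nE G) (nE H) (nE J))
    lab≡' : ∀ x → lab (G ⊕ (H ⊕ J)) (Aᴱ x) ≡ lab ((G ⊕ H) ⊕ J) x
    lab≡' x with splitView (nE G + nE H) (nE J) x
    ... | inr k rewrite +-assoc-↔-↑ʳ (nE G) (nE H) (nE J) k =
      trans (lab-⊕-↑ʳ G (H ⊕ J) _) (trans (lab-⊕-↑ʳ H J k) (sym (lab-⊕-↑ʳ (G ⊕ H) J k)))
    ... | inl y with splitView (nE G) (nE H) y
    ...   | inl i rewrite +-assoc-↔-↑ˡ↑ˡ (nE G) (nE H) (nE J) i =
      trans (lab-⊕-↑ˡ G (H ⊕ J) i) (sym (trans (lab-⊕-↑ˡ (G ⊕ H) J _) (lab-⊕-↑ˡ G H i)))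
    ...   | inr j rewrite +-assoc-↔-↑ʳ↑ˡ (nE G) (nE H) (nE J) j =
      trans (lab-⊕-↑ʳ G (H ⊕ J) _) (trans (lab-⊕-↑ˡ H J j) (sym (trans (lab-⊕-↑ˡ (G ⊕ H) J _) (lab-⊕-↑ʳ G H j))))
    attList≡' : ∀ x → attList (G ⊕ (H ⊕ J)) (Aᴱ x) ≡ map A (attList ((G ⊕ H) ⊕ J) x)
    attList≡' x with splitView (nE G + nE H) (nE J) x
    ... | inr k rewrite +-assoc-↔-↑ʳ (nE G) (nE H) (nE J) k | attList-⊕-↑ʳ (G ⊕ H) J k
                      | attList-⊕-↑ʳ G (H ⊕ J) (nE H ↑ʳ k) | attList-⊕-↑ʳ H J k =
      trans (map-map-≗ (λ _ → refl) _) (sym (map-map-≗ (+-assoc-↔-↑ʳ (nV G) (nV H) (nV J)) _))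
    ... | inl y with splitView (nE G) (nE H) y
    ...   | inl i rewrite +-assoc-↔-↑ˡ↑ˡ (nE G) (nE H) (nE J) i | attList-⊕-↑ˡ (G ⊕ H) J (i ↑ˡ nE H)
                        | attList-⊕-↑ˡ G H i | attList-⊕-↑ˡ G (H ⊕ J) i =
      sym (trans (cong (map A) (map-map-≗ (λ _ → refl) _)) (map-map-≗ (+-assoc-↔-↑ˡ↑ˡ (nV G) (nV H) (nV J)) _))
    ...   | inr j rewrite +-assoc-↔-↑ʳ↑ˡ (nE G) (nE H) (nE J) j | attList-⊕-↑ˡ (G ⊕ H) J (nE G ↑ʳ j)
                        | attList-⊕-↑ʳ G H j | attList-⊕-↑ʳ G (H ⊕ J) (j ↑ˡ nE J) | attList-⊕-↑ˡ H J j =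
      trans (map-map-≗ (λ _ → refl) _)
            (sym (trans (cong (map A) (map-map-≗ (λ _ → refl) _)) (map-map-≗ (+-assoc-↔-↑ʳ↑ˡ (nV G) (nV H) (nV J)) _)))
    eG = extList G
    eH = extList H
    eJ = extList J
    X = map (λ v → (v ↑ˡ nV H) ↑ˡ nV J) eG
    Y = map (λ v → (nV G ↑ʳ v) ↑ˡ nV J) eH
    Z = map ((nV G + nV H) ↑ʳ_) eJ
    extList≡' : extList (G ⊕ (H ⊕ J)) ≡ map A (extList ((G ⊕ H) ⊕ J))
    extList≡' = begin
      extList (G ⊕ (H ⊕ J))
        ≡⟨ trans (extList-⊕ G (H ⊕ J)) (cong (λ z → map (_↑ˡ (nV H + nV J)) eG ++ map (nV G ↑ʳ_) z) (extList-⊕ H J)) ⟩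
      map (_↑ˡ (nV H + nV J)) eG ++ map (nV G ↑ʳ_) (map (_↑ˡ nV J) eH ++ map (nV H ↑ʳ_) eJ)
        ≡⟨ cong (map (_↑ˡ (nV H + nV J)) eG ++_) (trans (map-++ (nV G ↑ʳ_) (map (_↑ˡ nV J) eH) (map (nV H ↑ʳ_) eJ))
              (cong₂ _++_ (map-map-≗ (λ _ → refl) eH) (map-map-≗ (λ _ → refl) eJ))) ⟩
      map (_↑ˡ (nV H + nV J)) eG ++ (map (λ v → nV G ↑ʳ (v ↑ˡ nV J)) eH ++ map (λ v → nV G ↑ʳ (nV H ↑ʳ v)) eJ)
        ≡⟨ ++-assoc (map (_↑ˡ (nV H + nV J)) eG) _ _ ⟨
      (map (_↑ˡ (nV H + nV J)) eG ++ map (λ v → nV G ↑ʳ (v ↑ˡ nV J)) eH) ++ map (λ v → nV G ↑ʳ (nV H ↑ʳ v)) eJ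
        ≡⟨ cong₂ _++_ (cong₂ _++_ (map-map-≗ (+-assoc-↔-↑ˡ↑ˡ (nV G) (nV H) (nV J)) eG)
                                   (map-map-≗ (+-assoc-↔-↑ʳ↑ˡ (nV G) (nV H) (nV J)) eH))
                      (map-map-≗ (+-assoc-↔-↑ʳ (nV G) (nV H) (nV J)) eJ) ⟨
      (map A (map (λ v → (v ↑ˡ nV H) ↑ˡ nV J) eG) ++ map A (map (λ v → (nV G ↑ʳ v) ↑ˡ nV J) eH))
        ++ map A (map ((nV G + nV H) ↑ʳ_) eJ)
        ≡⟨ trans (map-++ A (X ++ Y) Z) (cong (_++ map A Z) (map-++ A X Y)) ⟨
      map A ((map (λ v → (v ↑ˡ nV H) ↑ˡ nV J) eG ++ map (λ v → (nV G ↑ʳ v) ↑ˡ nV J) eH) ++ map ((nV G + nV H) ↑ʳ_) eJ)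
        ≡⟨ cong (λ z → map A (z ++ map ((nV G + nV H) ↑ʳ_) eJ))
             (trans (map-++ (_↑ˡ nV J) (map (_↑ˡ nV H) eG) (map (nV G ↑ʳ_) eH))
                    (cong₂ _++_ (map-map-≗ (λ _ → refl) eG) (map-map-≗ (λ _ → refl) eH))) ⟨
      map A (map (_↑ˡ nV J) (map (_↑ˡ nV H) eG ++ map (nV G ↑ʳ_) eH) ++ map ((nV G + nV H) ↑ʳ_) eJ)
        ≡⟨ cong (map A) (trans (extList-⊕ (G ⊕ H) J) (cong (λ z → map (_↑ˡ nV J) z ++ Z) (extList-⊕ G H))) ⟨
      map A (extList ((G ⊕ H) ⊕ J)) ∎

  -- The frame rule of hyperedge replacement: a component W disjoint from the hole may be added
  -- to the host, and a component V of rank zero to the filler.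
  module ⊕-Frame {B W X V K : Hyp L rk} {n : ℕ} {a : Fin n → Fin (nV B)}
                 (fl : Fill (holeCtx B n a) (λ _ → X) K) (V-rank0 : nExt V ≡ 0) where
    open FillProps fl
    private
      C = holeCtx B n a
      C' = holeCtx (B ⊕ W) n (λ i → a i ↑ˡ nV W)
      Hs' : Fin 1 → Hyp L rk
      Hs' _ = X ⊕ V
      K' = K ⊕ (V ⊕ W)
      vB = nV B
      vW = nV W
      vX = nV X
      vV = nV V
      vK = nV K
      eB = nE B
      eW = nE W
      eX = nE X
      eV = nE V
      eK = nE K

    f' : Fin (vB + vW) → Fin (vK + (vV + vW))
    f' b = [ (λ b₁ → f b₁ ↑ˡ (vV + vW)) , (λ w → vK ↑ʳ (vV ↑ʳ w)) ] (splitAt vB b)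

    g' : (j : Fin 1) → Fin (vX + vV) → Fin (vK + (vV + vW))
    g' j x = [ (λ x₁ → g j x₁ ↑ˡ (vV + vW)) , (λ v → vK ↑ʳ (v ↑ˡ vW)) ] (splitAt vX x)

    f'-↑ˡ : ∀ b → f' (b ↑ˡ vW) ≡ f b ↑ˡ (vV + vW)
    f'-↑ˡ b rewrite splitAt-↑ˡ vB b vW = refl

    f'-↑ʳ : ∀ w → f' (vB ↑ʳ w) ≡ vK ↑ʳ (vV ↑ʳ w)
    f'-↑ʳ w rewrite splitAt-↑ʳ vB vW w = refl

    g'-↑ˡ : ∀ j x → g' j (x ↑ˡ vV) ≡ g j x ↑ˡ (vV + vW)
    g'-↑ˡ j x rewrite splitAt-↑ˡ vX x vV = refl

    g'-↑ʳ : ∀ j v → g' j (vX ↑ʳ v) ≡ vK ↑ʳ (v ↑ˡ vW)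
    g'-↑ʳ j v rewrite splitAt-↑ʳ vX vV v = refl

    F' : NodeSum C' Hs' → Fin (vK + (vV + vW))
    F' = [ f' , uncurry g' ]

    embed : NodeSum C (λ _ → X) → NodeSum C' Hs'
    embed (inj₁ b) = inj₁ (b ↑ˡ vW)
    embed (inj₂ (j , x)) = inj₂ (j , x ↑ˡ vV)

    F'-embed : ∀ x → F' (embed x) ≡ F x ↑ˡ (vV + vW)
    F'-embed (inj₁ b) = f'-↑ˡ b
    F'-embed (inj₂ (j , x)) = g'-↑ˡ j x

    rep' : Fin (vK + (vV + vW)) → NodeSum C' Hs'
    rep' v = [ embed ∘ rep
             , (λ r → [ (λ v' → inj₂ (zero , vX ↑ʳ v')) , (λ w → inj₁ (vB ↑ʳ w)) ] (splitAt vV r)) ]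
             (splitAt vK v)

    rep'-↑ˡ : ∀ u → rep' (u ↑ˡ (vV + vW)) ≡ embed (rep u)
    rep'-↑ˡ u rewrite splitAt-↑ˡ vK u (vV + vW) = refl

    F'-rep : ∀ v → F' (rep' v) ≡ v
    F'-rep v with splitView vK (vV + vW) v
    ... | inl u rewrite rep'-↑ˡ u = trans (F'-embed (rep u)) (cong (_↑ˡ (vV + vW)) (F-rep u))
    ... | inr r rewrite splitAt-↑ʳ vK (vV + vW) r with splitView vV vW r
    ...   | inl v' rewrite splitAt-↑ˡ vV v' vW = g'-↑ʳ zero v'
    ...   | inr w rewrite splitAt-↑ʳ vV vW w = f'-↑ʳ w

    glue-embed : ∀ {x y} → Glue C (λ _ → X) x y → EqClosure (Glue C' Hs') (embed x) (embed y)
    glue-embed (glue j i i' i≡i') =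
      subst (λ z → EqClosure (Glue C' Hs') (inj₁ (a i ↑ˡ vW)) (inj₂ (j , z))) (ext-⊕-↑ˡ X V i')
            (single (glue j i (i' ↑ˡ nExt V) (trans i≡i' (sym (toℕ-↑ˡ i' (nExt V))))))

    glue-rep' : ∀ x → EqClosure (Glue C' Hs') x (rep' (F' x))
    glue-rep' (inj₁ b) with splitView vB vW b
    ... | inl b₁ rewrite f'-↑ˡ b₁ | rep'-↑ˡ (f b₁) =
      EC.gfold (EC.isEquivalence _) embed glue-embed (glue-rep (inj₁ b₁))
    ... | inr w rewrite f'-↑ʳ w | splitAt-↑ʳ vK (vV + vW) (vV ↑ʳ w) | splitAt-↑ʳ vV vW w = ε
    glue-rep' (inj₂ (zero , y)) with splitView vX vV y
    ... | inl x₁ rewrite g'-↑ˡ zero x₁ | rep'-↑ˡ (g zero x₁) =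
      EC.gfold (EC.isEquivalence _) embed glue-embed (glue-rep (inj₂ (zero , x₁)))
    ... | inr v' rewrite g'-↑ʳ zero v' | splitAt-↑ʳ vK (vV + vW) (v' ↑ˡ vW) | splitAt-↑ˡ vV v' vW = ε

    -- V has no external nodes, so every glue pair lies in the image of embed.
    F'-resp : ∀ {x y} → Glue C' Hs' x y → F' x ≡ F' y
    F'-resp (glue j i i₂ i≡i₂) with splitView (nExt X) (nExt V) i₂
    ... | inl i' rewrite ext-⊕-↑ˡ X V i' | f'-↑ˡ (a i) | g'-↑ˡ j (ext X i') =
      cong (_↑ˡ (vV + vW)) (F-resp (glue j i i' (trans i≡i₂ (toℕ-↑ˡ i' (nExt V)))))
    ... | inr k = ⊥-elim (Fin0-elim V-rank0 k)

    embedᴱ : EdgeSum C (λ _ → X) → EdgeSum C' Hs'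
    embedᴱ (inj₁ b) = inj₁ (b ↑ˡ eW)
    embedᴱ (inj₂ (j , x)) = inj₂ (j , x ↑ˡ eV)

    toᴱ : EdgeSum C' Hs' → Fin (eK + (eV + eW))
    toᴱ (inj₁ b) =
      [ (λ b₁ → to edges (inj₁ b₁) ↑ˡ (eV + eW)) , (λ w → eK ↑ʳ (eV ↑ʳ w)) ] (splitAt eB b)
    toᴱ (inj₂ (j , x)) =
      [ (λ x₁ → to edges (inj₂ (j , x₁)) ↑ˡ (eV + eW)) , (λ v → eK ↑ʳ (v ↑ˡ eW)) ] (splitAt eX x)

    fromᴱ : Fin (eK + (eV + eW)) → EdgeSum C' Hs'
    fromᴱ y = [ embedᴱ ∘ from edges
              , (λ r → [ (λ v → inj₂ (zero , eX ↑ʳ v)) , (λ w → inj₁ (eB ↑ʳ w)) ] (splitAt eV r)) ]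
              (splitAt eK y)

    toᴱ-embedᴱ : ∀ z → toᴱ (embedᴱ z) ≡ to edges z ↑ˡ (eV + eW)
    toᴱ-embedᴱ (inj₁ b) rewrite splitAt-↑ˡ eB b eW = refl
    toᴱ-embedᴱ (inj₂ (j , x)) rewrite splitAt-↑ˡ eX x eV = refl

    toᴱ-host-↑ʳ : ∀ w → toᴱ (inj₁ (eB ↑ʳ w)) ≡ eK ↑ʳ (eV ↑ʳ w)
    toᴱ-host-↑ʳ w rewrite splitAt-↑ʳ eB eW w = refl

    toᴱ-filler-↑ʳ : ∀ j v → toᴱ (inj₂ (j , eX ↑ʳ v)) ≡ eK ↑ʳ (v ↑ˡ eW)
    toᴱ-filler-↑ʳ j v rewrite splitAt-↑ʳ eX eV v = refl

    fromᴱ-↑ˡ : ∀ u → fromᴱ (u ↑ˡ (eV + eW)) ≡ embedᴱ (from edges u)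
    fromᴱ-↑ˡ u rewrite splitAt-↑ˡ eK u (eV + eW) = refl

    toᴱ-fromᴱ : ∀ y → toᴱ (fromᴱ y) ≡ y
    toᴱ-fromᴱ y with splitView eK (eV + eW) y
    ... | inl u rewrite fromᴱ-↑ˡ u =
      trans (toᴱ-embedᴱ (from edges u)) (cong (_↑ˡ (eV + eW)) (strictlyInverseˡ edges u))
    ... | inr r rewrite splitAt-↑ʳ eK (eV + eW) r with splitView eV eW r
    ...   | inl v rewrite splitAt-↑ˡ eV v eW | splitAt-↑ʳ eX eV v = refl
    ...   | inr w rewrite splitAt-↑ʳ eV eW w | splitAt-↑ʳ eB eW w = refl

    fromᴱ-toᴱ : ∀ z → fromᴱ (toᴱ z) ≡ z
    fromᴱ-toᴱ (inj₁ b) with splitView eB eW b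
    ... | inl b₁ rewrite splitAt-↑ˡ eB b₁ eW | fromᴱ-↑ˡ (to edges (inj₁ b₁))
                       | strictlyInverseʳ edges (inj₁ b₁) = refl
    ... | inr w rewrite splitAt-↑ʳ eB eW w | splitAt-↑ʳ eK (eV + eW) (eV ↑ʳ w) | splitAt-↑ʳ eV eW w = refl
    fromᴱ-toᴱ (inj₂ (zero , x)) with splitView eX eV x
    ... | inl x₁ rewrite splitAt-↑ˡ eX x₁ eV | fromᴱ-↑ˡ (to edges (inj₂ (zero , x₁)))
                       | strictlyInverseʳ edges (inj₂ (zero , x₁)) = refl
    ... | inr v rewrite splitAt-↑ʳ eX eV v | splitAt-↑ʳ eK (eV + eW) (v ↑ˡ eW) | splitAt-↑ˡ eV v eW = refl

    edges' : EdgeSum C' Hs' ↔ Fin (eK + (eV + eW))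
    edges' = mk↔ₛ′ toᴱ fromᴱ toᴱ-fromᴱ fromᴱ-toᴱ

    labˡ' : ∀ b → lab K' (toᴱ (inj₁ b)) ≡ lab (B ⊕ W) b
    labˡ' b with splitView eB eW b
    ... | inl b₁ rewrite splitAt-↑ˡ eB b₁ eW = trans (lab-⊕-↑ˡ K (V ⊕ W) _) (labˡ b₁)
    ... | inr w rewrite splitAt-↑ʳ eB eW w = trans (lab-⊕-↑ʳ K (V ⊕ W) _) (lab-⊕-↑ʳ V W w)

    labʳ' : ∀ j x → lab K' (toᴱ (inj₂ (j , x))) ≡ lab (X ⊕ V) x
    labʳ' j x with splitView eX eV x
    ... | inl x₁ rewrite splitAt-↑ˡ eX x₁ eV = trans (lab-⊕-↑ˡ K (V ⊕ W) _) (labʳ j x₁)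
    ... | inr v rewrite splitAt-↑ʳ eX eV v = trans (lab-⊕-↑ʳ K (V ⊕ W) _) (lab-⊕-↑ˡ V W v)

    attˡ' : ∀ b → attList K' (toᴱ (inj₁ b)) ≡ map f' (attList (B ⊕ W) b)
    attˡ' b with splitView eB eW b
    ... | inl b₁ = trans (cong (attList K') (toᴱ-embedᴱ (inj₁ b₁)))
                   (trans (attList-⊕-↑ˡ K (V ⊕ W) _)
                   (trans (cong (map (_↑ˡ (vV + vW))) (attˡ b₁))
                   (trans (map-square (λ v → sym (f'-↑ˡ v)) _)
                          (cong (map f') (sym (attList-⊕-↑ˡ B W b₁))))))
    ... | inr w = trans (cong (attList K') (toᴱ-host-↑ʳ w))
                  (trans (attList-⊕-↑ʳ K (V ⊕ W) _)
                  (trans (cong (map (vK ↑ʳ_)) (attList-⊕-↑ʳ V W w))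
                  (trans (map-square (λ v → sym (f'-↑ʳ v)) _)
                         (cong (map f') (sym (attList-⊕-↑ʳ B W w))))))

    attʳ' : ∀ j x → attList K' (toᴱ (inj₂ (j , x))) ≡ map (g' j) (attList (X ⊕ V) x)
    attʳ' j x with splitView eX eV x
    ... | inl x₁ = trans (cong (attList K') (toᴱ-embedᴱ (inj₂ (j , x₁))))
                   (trans (attList-⊕-↑ˡ K (V ⊕ W) _)
                   (trans (cong (map (_↑ˡ (vV + vW))) (attʳ j x₁))
                   (trans (map-square (λ v → sym (g'-↑ˡ j v)) _)
                          (cong (map (g' j)) (sym (attList-⊕-↑ˡ X V x₁))))))
    ... | inr v = trans (cong (attList K') (toᴱ-filler-↑ʳ j v))
                  (trans (attList-⊕-↑ʳ K (V ⊕ W) _)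
                  (trans (cong (map (vK ↑ʳ_)) (attList-⊕-↑ˡ V W v))
                  (trans (map-square (λ u → sym (g'-↑ʳ j u)) _)
                         (cong (map (g' j)) (sym (attList-⊕-↑ʳ X V v))))))

    extOk' : extList K' ≡ map f' (extList (B ⊕ W))
    extOk' = begin
      extList K'
        ≡⟨ extList-⊕ K (V ⊕ W) ⟩
      map (_↑ˡ (vV + vW)) (extList K) ++ map (vK ↑ʳ_) (extList (V ⊕ W))
        ≡⟨ cong₂ (λ z z' → map (_↑ˡ (vV + vW)) z ++ map (vK ↑ʳ_) z') extOk (extList-⊕ V W) ⟩
      map (_↑ˡ (vV + vW)) (map f (extList B)) ++ map (vK ↑ʳ_) (map (_↑ˡ vW) (extList V) ++ map (vV ↑ʳ_) (extList W))
        ≡⟨ cong (λ z → map (_↑ˡ (vV + vW)) (map f (extList B)) ++ map (vK ↑ʳ_) (map (_↑ˡ vW) z ++ map (vV ↑ʳ_) (extList W)))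
                (tabulate-0 (ext V) V-rank0) ⟩
      map (_↑ˡ (vV + vW)) (map f (extList B)) ++ map (vK ↑ʳ_) (map (vV ↑ʳ_) (extList W))
        ≡⟨ cong₂ _++_ (trans (map-map-≗ (λ _ → refl) (extList B)) (sym (map-map-≗ f'-↑ˡ (extList B))))
                      (trans (map-map-≗ (λ _ → refl) (extList W)) (sym (map-map-≗ f'-↑ʳ (extList W)))) ⟩
      map f' (map (_↑ˡ vW) (extList B)) ++ map f' (map (vB ↑ʳ_) (extList W))
        ≡⟨ map-++ f' (map (_↑ˡ vW) (extList B)) (map (vB ↑ʳ_) (extList W)) ⟨
      map f' (map (_↑ˡ vW) (extList B) ++ map (vB ↑ʳ_) (extList W))
        ≡⟨ cong (map f') (extList-⊕ B W) ⟨
      map f' (extList (B ⊕ W)) ∎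
      where open ≡-Reasoning

    fill : Fill C' Hs' K'
    fill = mkFill C' Hs' K' (λ j → trans (rkOk j) (sym (trans (cong (nExt X +_) V-rank0) (+-identityʳ _))))
      f' g' rep' F'-rep glue-rep' F'-resp edges' labˡ' labʳ' attˡ' attʳ' extOk'

  Fill-⊕-frame : {B W X V K : Hyp L rk} {n : ℕ} {a : Fin n → Fin (nV B)} →
                 Fill (holeCtx B n a) (λ _ → X) K → nExt V ≡ 0 →
                 Fill (holeCtx (B ⊕ W) n (λ i → a i ↑ˡ nV W)) (λ _ → X ⊕ V) (K ⊕ (V ⊕ W))
  Fill-⊕-frame fl V-rank0 = ⊕-Frame.fill fl V-rank0

-- Hypergraphs over primitive types

module _ {Nt : Set} (rkN : Nt → ℕ) where
  private
    T = Tp rkN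
    rkT = rk rkN

  primsCtx : Ctx Nt rkN → Ctx T rkT
  primsCtx C = record { base = prims rkN (base C) ; nH = nH C ; hrk = hrk C ; hatt = hatt C }

  Fill-prims : {C : Ctx Nt rkN} {Hs : Fin (nH C) → Hyp Nt rkN} {K : Hyp Nt rkN} →
               Fill C Hs K → Fill (primsCtx C) (λ j → prims rkN (Hs j)) (prims rkN K)
  Fill-prims {C} {Hs} {K} fl =
    mkFill (primsCtx C) (λ j → prims rkN (Hs j)) (prims rkN K) rkOk f g rep F-rep
      (λ x → EC.map (λ { (glue j i i' eq) → glue j i i' eq }) (glue-rep x))
      (λ { (glue j i i' eq) → F-resp (glue j i i' eq) })
      edges (λ e → cong prim (labˡ e)) (λ j h → cong prim (labʳ j h)) attˡ attʳ extOk
    where open FillProps fl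

  Iso-prims : {Y Y' : Hyp Nt rkN} → Iso Y Y' → Iso (prims rkN Y) (prims rkN Y')
  Iso-prims φ = record
    { nodeIso = nodeIso φ ; edgeIso = edgeIso φ ; lab≡ = λ e → cong prim (lab≡ φ e)
    ; attList≡ = attList≡ φ ; extList≡ = extList≡ φ }

  ⊢-handle : (A : T) → ⊢_⇒_ rkN (handle A) A
  ⊢-handle A = ax (Iso⇒≅ (Iso-refl _))

  divCtx-fill-handles : (N : T) (D : Hyp T rkT) (dAtt : Fin 0 → Fin (nV D)) (p : rkT N ≡ nExt D) →
                        Fill (divCtx rkN N D 0 dAtt p) (λ i → handle (lab D i)) (D ⊕ handle (div N D 0 dAtt p))
  divCtx-fill-handles N D dAtt p =
    mkFill C Hs (D ⊕ h) (λ _ → refl) f g (inj₁ ∘ unpad) F-rep glue-rep F-resp edges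
      (λ { zero → lab-⊕-↑ʳ D h zero }) (λ { i zero → lab-⊕-↑ˡ D h i })
      (λ { zero → attList-⊕-↑ʳ D h zero })
      (λ { i zero → trans (attList-⊕-↑ˡ D h i)
                          (trans (map-tabulate (att D i) (_↑ˡ 0)) (sym (map-tabulate (λ v → v) (g i)))) })
      (trans (extList-⊕ D h) (++-identityʳ _))
    where
    C = divCtx rkN N D 0 dAtt p
    Hs : Fin (nE D) → Hyp T rkT
    Hs i = handle (lab D i)
    h = handle {rk = rkT} (div N D 0 dAtt p)
    pad = +-identityʳ-↔ (nV D)
    unpad = from pad
    f : Fin (nV D) → Fin (nV D + 0)
    f = to pad
    g : (i : Fin (nE D)) → Fin (rkT (lab D i)) → Fin (nV D + 0)
    g i v = f (att D i v)
    F = [ f , uncurry g ]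
    F-rep : ∀ u → F (inj₁ (unpad u)) ≡ u
    F-rep = strictlyInverseˡ pad
    glue-rep : ∀ x → EqClosure (Glue C Hs) x (inj₁ (unpad (F x)))
    glue-rep (inj₁ b) = ≡⇒EqClosure (cong inj₁ (sym (strictlyInverseʳ pad b)))
    glue-rep (inj₂ (i , v)) = subst (λ z → EqClosure (Glue C Hs) (inj₂ (i , v)) (inj₁ z))
                                (sym (strictlyInverseʳ pad (att D i v))) (bwd (glue i v v refl) ◅ ε)
    F-resp : ∀ {x y} → Glue C Hs x y → F x ≡ F y
    F-resp (glue i v v' eq) = cong (g i) (toℕ-injective eq)
    EdgesD = Fin 1 ⊎ Σ (Fin (nE D)) (λ _ → Fin 1)
    edgeTo : EdgesD → Fin (nE D + 1)
    edgeTo (inj₁ _) = nE D ↑ʳ zero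
    edgeTo (inj₂ (i , _)) = i ↑ˡ 1
    edgeFrom : Fin (nE D + 1) → EdgesD
    edgeFrom y = [ (λ i → inj₂ (i , zero)) , (λ _ → inj₁ zero) ] (splitAt (nE D) y)
    to-from : ∀ y → edgeTo (edgeFrom y) ≡ y
    to-from y with splitView (nE D) 1 y
    ... | inl i rewrite splitAt-↑ˡ (nE D) i 1 = refl
    ... | inr zero rewrite splitAt-↑ʳ (nE D) 1 zero = refl
    from-to : ∀ z → edgeFrom (edgeTo z) ≡ z
    from-to (inj₁ zero) rewrite splitAt-↑ʳ (nE D) 1 zero = refl
    from-to (inj₂ (i , zero)) rewrite splitAt-↑ˡ (nE D) i 1 = refl
    edges : EdgesD ↔ Fin (nE D + 1)
    edges = mk↔ₛ′ edgeTo edgeFrom to-from from-to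

-- Simulating derivations

module _ {L : Set} {rk : L → ℕ} where
  addEdge : (B : Hyp L rk) (t : L) → (Fin (rk t) → Fin (nV B)) → Hyp L rk
  addEdge B t at = record B
    { nE = suc (nE B)
    ; lab = λ { zero → t ; (suc e) → lab B e }
    ; att = λ { zero → at ; (suc e) → att B e } }

  multiSum : (m : ℕ) → (Fin m → ℕ) → (Fin m → Hyp L rk) → Hyp L rk
  multiSum m c hs = bigSum m (λ r → c r · hs r)

  nExt-· : ∀ k (X : Hyp L rk) → nExt X ≡ 0 → nExt (k · X) ≡ 0
  nExt-· zero    X X-rank0 = refl
  nExt-· (suc k) X X-rank0 = cong₂ _+_ X-rank0 (nExt-· k X X-rank0)

  multiSum-zero : ∀ m (hs : Fin m → Hyp L rk) → Iso emptyH (multiSum m (λ _ → 0) hs)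
  multiSum-zero zero    hs = Iso-refl emptyH
  multiSum-zero (suc m) hs = multiSum-zero m (hs ∘ suc)

  multiSum-insert : ∀ m c (hs : Fin m → Hyp L rk) → (∀ r → nExt (hs r) ≡ 0) → ∀ i →
                    Iso (hs i ⊕ multiSum m c hs) (multiSum m (updateAt c i suc) hs)
  multiSum-insert (suc m) c hs hs-rank0 zero =
    Iso-sym (⊕-assoc (hs zero) (c zero · hs zero) (multiSum m (c ∘ suc) (hs ∘ suc)))
  multiSum-insert (suc m) c hs hs-rank0 (suc i) =
    Iso-trans (Iso-sym (⊕-assoc A B Rest))
    (Iso-trans (⊕-cong (⊕-comm A B (hs-rank0 (suc i)) (nExt-· (c zero) (hs zero) (hs-rank0 zero))) (Iso-refl Rest))
    (Iso-trans (⊕-assoc B A Rest)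
    (⊕-cong (Iso-refl B) (multiSum-insert m (c ∘ suc) (hs ∘ suc) (hs-rank0 ∘ suc) i))))
    where
    A = hs (suc i)
    B = c zero · hs zero
    Rest = multiSum m (c ∘ suc) (hs ∘ suc)

  multiSum-cong : ∀ m {c c'} (hs : Fin m → Hyp L rk) → (∀ r → c r ≡ c' r) →
                  multiSum m c hs ≡ multiSum m c' hs
  multiSum-cong zero    hs c≡c' = refl
  multiSum-cong (suc m) hs c≡c' =
    cong₂ _⊕_ (cong (_· hs zero) (c≡c' zero)) (multiSum-cong m (hs ∘ suc) (c≡c' ∘ suc))

module _ {Nt : Set} (rkN : Nt → ℕ) where
  private
    T = Tp rkN
    rkT = rk rkN

  ⊢-Step : ∀ {r G G₁} → Step rkN r G G₁ → (W : Hyp T rkT) {A : T} →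
           ⊢_⇒_ rkN (prims rkN G ⊕ W) A → ⊢_⇒_ rkN (prims rkN G₁ ⊕ (handle (DPO rkN r) ⊕ W)) A
  ⊢-Step {r} s W ⊢G⊕W =
    divL H zero refl ⊢H (λ i → handle (lab (prims rkN (hatR r)) i)) (λ i → ⊢-handle rkN _)
      (divCtx-fill-handles rkN _ _ _ _)
      (Fill-⊕-frame (Fill-prims rkN repR) refl)
    where
    open Step s
    H = addEdge (prims rkN C' ⊕ W) (times (prims rkN (hatL r))) (λ i → e0 i ↑ˡ nV W)
    ⊢H : ⊢_⇒_ rkN H _
    ⊢H = timesL H zero refl
           (Fill-resp-fillers (Fill-⊕-frame {V = emptyH} (Fill-prims rkN repL) refl)
                              (λ _ → Iso-sym (⊕-identityʳ _)))
           ⊢G⊕W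

  count-step : ∀ {m} {PN : Fin m → Rule rkN} {G G₁ H} (i : Fin m) (s : Step rkN (PN i) G G₁)
               (δ : Derivs rkN PN G₁ H) (c : Fin m → ℕ) r →
               updateAt c i suc r + count rkN δ r ≡ c r + count rkN (step i s δ) r
  count-step i s δ c r with i ≟ r
  ... | yes refl = trans (cong (_+ count rkN δ i) (updateAt-updates i c)) (sym (+-suc (c i) (count rkN δ i)))
  ... | no i≢r   = cong (_+ count rkN δ r) (updateAt-minimal r i c (λ r≡i → i≢r (sym r≡i)))

  module _ {m : ℕ} (PN : Fin m → Rule rkN) where
    dpoHandle : Fin m → Hyp T rkT
    dpoHandle r = handle (DPO rkN (PN r))

    ⊢-Derivs : ∀ {Y Y'} (δ : Derivs rkN PN Y Y') (c : Fin m → ℕ) {A : T} →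
               ⊢_⇒_ rkN (prims rkN Y ⊕ multiSum m c dpoHandle) A →
               ⊢_⇒_ rkN (prims rkN Y' ⊕ multiSum m (λ r → c r + count rkN δ r) dpoHandle) A
    ⊢-Derivs (done Y≅Y') c ⊢Y =
      subst (λ Z → ⊢_⇒_ rkN (_ ⊕ Z) _) (multiSum-cong m dpoHandle (λ r → sym (+-identityʳ (c r))))
        (⊢-resp-Iso rkN ⊢Y (⊕-cong (Iso-prims rkN (≅⇒Iso Y≅Y')) (Iso-refl _)))
    ⊢-Derivs (step i s δ) c ⊢Y =
      subst (λ Z → ⊢_⇒_ rkN (_ ⊕ Z) _) (multiSum-cong m dpoHandle (count-step i s δ c))
        (⊢-Derivs δ (updateAt c i suc)
          (⊢-resp-Iso rkN (⊢-Step s (multiSum m c dpoHandle) ⊢Y)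
            (⊕-cong (Iso-refl _) (multiSum-insert m c dpoHandle (λ _ → refl) i))))

lemma2 : {Nt : Set} (rkN : Nt → ℕ) {m : ℕ} (PN : Fin m → Rule rkN)
         (Y Y' : Hyp Nt rkN) (δ : Derivs rkN PN Y Y') (A : Tp rkN) →
         ⊢_⇒_ rkN (prims rkN Y) A →
         ⊢_⇒_ rkN (prims rkN Y' ⊕ bigSum m (λ r → count rkN δ r · handle (DPO rkN (PN r)))) A
lemma2 rkN {m} PN Y Y' δ A ⊢Y =
  ⊢-Derivs rkN PN δ (λ _ → 0) (⊢-resp-Iso rkN ⊢Y Y≃Y⊕0)
  where
  Y≃Y⊕0 : Iso (prims rkN Y) (prims rkN Y ⊕ multiSum m (λ _ → 0) (dpoHandle rkN PN))
  Y≃Y⊕0 = Iso-trans (⊕-identityʳ _) (⊕-cong (Iso-refl _) (multiSum-zero m (dpoHandle rkN PN)))
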